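{- Let $n$ and $r$ be positive integers. Let $P(n,r)$ denote the number of lattice paths in the plane using unit steps $(1,0)$ and $(0,1)$ from $(0,0)$ to $(n+r,\,n+r-1)$ that never touch any point of the set $\{(x,x)\in\mathbb{Z}^2 : x\ge r\}$. For positive integers $a,b$, let $Q(a,b)$ denote the number of lattice paths in the plane using unit steps $(1,0)$ and $(0,1)$ from $(0,0)$ to $(a+b,\,a+b-1)$ that never touch any point of the set $\{(x,x)\in\mathbb{Z}^2 : 1\le x\le b\}$. Then \[ P(n,r)=Q(r,n), \] i.e., $P(n,r)$ equals the number of such lattice paths from $(0,0)$ to $(n+r,\,n+r-1)$ that never touch any point of $\{(x,x)\in\mathbb{Z}^2 : 1\le x\le n\}$.
   Context: $P(n,r)$ is called the Gessel number. -}

module Defs where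

open import Data.Nat using (ℕ; zero; suc; _+_; _∸_; _≤ᵇ_; _≡ᵇ_)
open import Data.Bool using (Bool; true; false; _∧_; _∨_; not; if_then_else_)
open import Data.List using (List; []; _∷_; map; _++_; filter; length)
open import Data.Product using (_×_; _,_; proj₁; proj₂)
open import Relation.Nullary.Decidable using (Dec)
open import Relation.Binary.PropositionalEquality using (_≡_)
open import Data.Bool.Properties using (T?)

data Step : Set where
  E N : Step

Point : Set
Point = ℕ × ℕ

move : Point → Step → Point
move (x , y) E = (suc x , y)
move (x , y) N = (x , suc y)

visited : Point → List Step → List Point
visited p [] = p ∷ []
visited p (s ∷ ss) = p ∷ visited (move p s) ss

endpoint : Point → List Step → Point
endpoint p [] = p
endpoint p (s ∷ ss) = endpoint (move p s) ss

allB : {A : Set} → (A → Bool) → List A → Bool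
allB f [] = true
allB f (x ∷ xs) = f x ∧ allB f xs

words : ℕ → List (List Step)
words zero = [] ∷ []
words (suc k) = map (E ∷_) (words k) ++ map (N ∷_) (words k)

pathsTo : ℕ → ℕ → List (List Step)
pathsTo a b = filter (λ w → T? ((proj₁ (endpoint (0 , 0) w) ≡ᵇ a) ∧ (proj₂ (endpoint (0 , 0) w) ≡ᵇ b))) (words (a + b))

countAvoiding : (Point → Bool) → ℕ → ℕ → ℕ
countAvoiding bad a b =
  length (filter (λ w → T? (allB (λ p → not (bad p)) (visited (0 , 0) w))) (pathsTo a b))

badP : ℕ → Point → Bool
badP r (x , y) = (x ≡ᵇ y) ∧ (r ≤ᵇ x)

badQ : ℕ → Point → Bool
badQ b (x , y) = (x ≡ᵇ y) ∧ ((1 ≤ᵇ x) ∧ (x ≤ᵇ b))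

P : ℕ → ℕ → ℕ
P n r = countAvoiding (badP r) (n + r) ((n + r) ∸ 1)

Q : ℕ → ℕ → ℕ
Q a b = countAvoiding (badQ b) (a + b) ((a + b) ∸ 1)

{-# OPTIONS --safe #-}
-- Reversing a path and turning the plane by a half-turn maps the paths counted by
-- P(n,r) onto the paths from (0,0) to (n+r, n+r-1) that avoid the points (x, x-1),
-- 1 ≤ x ≤ n.  These are compared with the paths counted by Q(r,n) through the
-- reflection ρ(x,y) = (y+1, x-1) in the line y = x - 1/2, which fixes the points
-- (x, x-1) and exchanges E- and N-steps.  Hence for both families the folded count
-- (paths to p plus paths to ρ p) satisfies the path recursion at every admissible point.
-- At the forbidden points (i,i) of Q the two recursions fail in compensating ways, so
-- the folded counts agree everywhere except at the fixed points (i, i-1) with i ≤ n.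
-- The end point (n+r, n+r-1) is entered from the mirror pair (n+r-1, n+r-1),
-- (n+r, n+r-2), so both path counts equal the folded count there.
module Submission where

open import Data.Bool using (Bool; true; false; not; _∧_; T)
open import Data.Bool.Properties using (T?; T-∧; ∧-assoc; ∧-identityʳ; ∧-zeroʳ)
open import Data.Empty using (⊥-elim)
open import Data.List using (List; []; _∷_; map; _++_; filter; length)
open import Data.Nat using (ℕ; zero; suc; _+_; _*_; _∸_; _≡ᵇ_; _≤ᵇ_; _≤_; _<_; _≥_; s≤s)
open import Data.Nat.Properties
open import Data.Nat.Tactic.RingSolver using (solve-∀)
open import Data.Product using (_×_; _,_; proj₁; proj₂)
import Data.Product as Product
open import Data.Sum using (_⊎_; inj₁; inj₂; [_,_])
import Data.Sum as Sum
open import Data.Unit using (tt)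
open import Function using (id; _∘_; case_of_)
open import Function.Bundles using (Equivalence)
open import Relation.Nullary using (¬_; yes; no)
open import Relation.Binary.PropositionalEquality hiding ([_])

open import Defs

𝟙 : Bool → ℕ
𝟙 true  = 1
𝟙 false = 0

𝟙-∧ : ∀ a b → 𝟙 (a ∧ b) ≡ 𝟙 a * 𝟙 b
𝟙-∧ true  b = sym (+-identityʳ (𝟙 b))
𝟙-∧ false b = refl

T⇒≡true : ∀ {b} → T b → b ≡ true
T⇒≡true {true} _ = refl

¬T⇒≡false : ∀ {b} → ¬ T b → b ≡ false
¬T⇒≡false {true}  ¬t = ⊥-elim (¬t tt)
¬T⇒≡false {false} _  = refl

not≡false⇒T : ∀ {b} → not b ≡ false → T b
not≡false⇒T {true} _ = tt

T⇔T⇒≡ : ∀ {a b} → (T a → T b) → (T b → T a) → a ≡ b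
T⇔T⇒≡ {true}  {true}  _ _ = refl
T⇔T⇒≡ {true}  {false} f _ = ⊥-elim (f tt)
T⇔T⇒≡ {false} {true}  _ g = ⊥-elim (g tt)
T⇔T⇒≡ {false} {false} _ _ = refl

true-or-false : ∀ b → b ≡ true ⊎ b ≡ false
true-or-false true  = inj₁ refl
true-or-false false = inj₂ refl

≡ᵇ-refl : ∀ m → (m ≡ᵇ m) ≡ true
≡ᵇ-refl zero    = refl
≡ᵇ-refl (suc m) = ≡ᵇ-refl m

≢⇒≡ᵇ-false : ∀ {m n} → m ≢ n → (m ≡ᵇ n) ≡ false
≢⇒≡ᵇ-false {m} {n} m≢n = ¬T⇒≡false (m≢n ∘ ≡ᵇ⇒≡ m n)

≡ᵇ-shift : ∀ {u w x y} → u + x ≡ w + y → (x ≡ᵇ y) ≡ (u ≡ᵇ w)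
≡ᵇ-shift {u} {w} {x} {y} e = T⇔T⇒≡
  (λ t → ≡⇒≡ᵇ u w (+-cancelʳ-≡ x u w (trans e (cong (w +_) (sym (≡ᵇ⇒≡ x y t))))))
  (λ t → ≡⇒≡ᵇ x y (+-cancelˡ-≡ w x y (trans (cong (_+ x) (sym (≡ᵇ⇒≡ u w t))) e)))

n≢2+n : ∀ n → n ≢ suc (suc n)
n≢2+n n = <⇒≢ (m<n⇒m<1+n (n<1+n n))

≤ᵇ-shift : ∀ {u n x r} → u + x ≡ n + r → (r ≤ᵇ x) ≡ (u ≤ᵇ n)
≤ᵇ-shift {u} {n} {x} {r} e = T⇔T⇒≡
  (λ t → ≤⇒≤ᵇ (+-cancelʳ-≤ x u n
            (subst (_≤ n + x) (sym e) (+-monoʳ-≤ n (≤ᵇ⇒≤ r x t)))))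
  (λ t → ≤⇒≤ᵇ (+-cancelˡ-≤ n r x
            (subst (_≤ n + x) e (+-monoˡ-≤ x (≤ᵇ⇒≤ u n t)))))

count : ∀ {A : Set} → (A → Bool) → List A → ℕ
count f []       = 0
count f (x ∷ xs) = 𝟙 (f x) + count f xs

module _ {A : Set} where

  length-filter : ∀ (f : A → Bool) xs → length (filter (λ x → T? (f x)) xs) ≡ count f xs
  length-filter f [] = refl
  length-filter f (x ∷ xs) with f x
  ... | true  = cong suc (length-filter f xs)
  ... | false = length-filter f xs

  count-filter : ∀ (f h : A → Bool) xs →
                 count f (filter (λ x → T? (h x)) xs) ≡ count (λ x → f x ∧ h x) xs
  count-filter f h [] = refl
  count-filter f h (x ∷ xs) with h x
  ... | true  = cong₂ _+_ (cong 𝟙 (sym (∧-identityʳ (f x)))) (count-filter f h xs)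
  ... | false = trans (count-filter f h xs) (cong (λ b → 𝟙 b + _) (sym (∧-zeroʳ (f x))))

  count-++ : ∀ (f : A → Bool) xs ys → count f (xs ++ ys) ≡ count f xs + count f ys
  count-++ f []       ys = refl
  count-++ f (x ∷ xs) ys = trans (cong (𝟙 (f x) +_) (count-++ f xs ys)) (sym (+-assoc (𝟙 (f x)) _ _))

  count-cong : ∀ {f h : A → Bool} → (∀ x → f x ≡ h x) → ∀ xs → count f xs ≡ count h xs
  count-cong f≗h []       = refl
  count-cong f≗h (x ∷ xs) = cong₂ _+_ (cong 𝟙 (f≗h x)) (count-cong f≗h xs)

  count-const-∧ : ∀ c (f : A → Bool) xs → count (λ x → c ∧ f x) xs ≡ 𝟙 c * count f xs
  count-const-∧ true  f xs       = sym (+-identityʳ _)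
  count-const-∧ false f []       = refl
  count-const-∧ false f (x ∷ xs) = count-const-∧ false f xs

count-map : ∀ {A B : Set} (f : A → Bool) (g : B → A) xs → count f (map g xs) ≡ count (f ∘ g) xs
count-map f g []       = refl
count-map f g (x ∷ xs) = cong (𝟙 (f (g x)) +_) (count-map f g xs)

avoid : (Point → Bool) → Point → Bool
avoid bad p = not (bad p)

_≡ᵖ_ : Point → Point → Bool
p ≡ᵖ q = (proj₁ p ≡ᵇ proj₁ q) ∧ (proj₂ p ≡ᵇ proj₂ q)

≡ᵖ⇒≡ : ∀ {p q} → T (p ≡ᵖ q) → p ≡ q
≡ᵖ⇒≡ {x , y} {x′ , y′} t with Equivalence.to T-∧ t
... | tx , ty = cong₂ _,_ (≡ᵇ⇒≡ x x′ tx) (≡ᵇ⇒≡ y y′ ty)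

paths : (Point → Bool) → Point → ℕ → Point → ℕ
paths g p zero    t = 𝟙 (g p) * 𝟙 (p ≡ᵖ t)
paths g p (suc k) t = 𝟙 (g p) * (paths g (move p E) k t + paths g (move p N) k t)

count-words≡paths : ∀ (g : Point → Bool) p k t →
  count (λ w → allB g (visited p w) ∧ (endpoint p w ≡ᵖ t)) (words k) ≡ paths g p k t
count-words≡paths g p zero t =
  trans (+-identityʳ _)
        (trans (cong (λ c → 𝟙 (c ∧ (p ≡ᵖ t))) (∧-identityʳ (g p))) (𝟙-∧ (g p) _))
count-words≡paths g p (suc k) t = begin
    count F (map (E ∷_) (words k) ++ map (N ∷_) (words k))
  ≡⟨ count-++ F (map (E ∷_) (words k)) _ ⟩
    count F (map (E ∷_) (words k)) + count F (map (N ∷_) (words k))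
  ≡⟨ cong₂ _+_ (first-step E) (first-step N) ⟩
    𝟙 (g p) * paths g (move p E) k t + 𝟙 (g p) * paths g (move p N) k t
  ≡⟨ sym (*-distribˡ-+ (𝟙 (g p)) _ _) ⟩
    paths g p (suc k) t
  ∎
  where
  open ≡-Reasoning
  F : List Step → Bool
  F w = allB g (visited p w) ∧ (endpoint p w ≡ᵖ t)
  first-step : ∀ s → count F (map (s ∷_) (words k)) ≡ 𝟙 (g p) * paths g (move p s) k t
  first-step s = begin
      count F (map (s ∷_) (words k))
    ≡⟨ count-map F (s ∷_) (words k) ⟩
      count (λ w → (g p ∧ allB g (visited (move p s) w)) ∧ (endpoint (move p s) w ≡ᵖ t)) (words k)
    ≡⟨ count-cong (λ w → ∧-assoc (g p) _ _) (words k) ⟩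
      count (λ w → g p ∧ (allB g (visited (move p s) w) ∧ (endpoint (move p s) w ≡ᵖ t))) (words k)
    ≡⟨ count-const-∧ (g p) _ (words k) ⟩
      𝟙 (g p) * count (λ w → allB g (visited (move p s) w) ∧ (endpoint (move p s) w ≡ᵖ t)) (words k)
    ≡⟨ cong (𝟙 (g p) *_) (count-words≡paths g (move p s) k t) ⟩
      𝟙 (g p) * paths g (move p s) k t
    ∎

countAvoiding≡paths : ∀ bad a b → countAvoiding bad a b ≡ paths (avoid bad) (0 , 0) (a + b) (a , b)
countAvoiding≡paths bad a b =
  trans (length-filter good (filter (λ w → T? (ends w)) (words (a + b))))
        (trans (count-filter good ends (words (a + b)))
               (count-words≡paths (avoid bad) (0 , 0) (a + b) (a , b)))
  where
  good ends : List Step → Bool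
  good w = allB (avoid bad) (visited (0 , 0) w)
  ends w = endpoint (0 , 0) w ≡ᵖ (a , b)

paths-unreachable : ∀ (g : Point → Bool) p k t → proj₁ t < proj₁ p ⊎ proj₂ t < proj₂ p →
                    paths g p k t ≡ 0
paths-unreachable g p zero t beyond =
  trans (cong (λ b → 𝟙 (g p) * 𝟙 b) (¬T⇒≡false (p≢t ∘ ≡ᵖ⇒≡))) (*-zeroʳ (𝟙 (g p)))
  where
  p≢t : p ≢ t
  p≢t refl = [ <-irrefl refl , <-irrefl refl ] beyond
paths-unreachable g p@(x , y) (suc k) t beyond =
  trans (cong₂ (λ a b → 𝟙 (g p) * (a + b))
                 (paths-unreachable g (suc x , y) k t (Sum.map m<n⇒m<1+n id beyond))
                 (paths-unreachable g (x , suc y) k t (Sum.map id m<n⇒m<1+n beyond)))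
        (*-zeroʳ (𝟙 (g p)))

beforeE : (Point → ℕ) → Point → ℕ
beforeE f (zero  , y) = 0
beforeE f (suc x , y) = f (x , y)

beforeN : (Point → ℕ) → Point → ℕ
beforeN f (x , zero)  = 0
beforeN f (x , suc y) = f (x , y)

beforeE-linear : ∀ c (f h : Point → ℕ) t →
                 beforeE (λ q → c * (f q + h q)) t ≡ c * (beforeE f t + beforeE h t)
beforeE-linear c f h (zero  , y) = sym (*-zeroʳ c)
beforeE-linear c f h (suc x , y) = refl

beforeN-linear : ∀ c (f h : Point → ℕ) t →
                 beforeN (λ q → c * (f q + h q)) t ≡ c * (beforeN f t + beforeN h t)
beforeN-linear c f h (x , zero)  = sym (*-zeroʳ c)
beforeN-linear c f h (x , suc y) = refl

𝟙-at-target : ∀ (g : Point → Bool) q t → 𝟙 (g q) * 𝟙 (q ≡ᵖ t) ≡ 𝟙 (g t) * 𝟙 (q ≡ᵖ t)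
𝟙-at-target g q t with q ≡ᵖ t in q≡ᵖt
... | true  = cong (λ z → 𝟙 (g z) * 1) (≡ᵖ⇒≡ (subst T (sym q≡ᵖt) tt))
... | false = trans (*-zeroʳ (𝟙 (g q))) (sym (*-zeroʳ (𝟙 (g t))))

last-step-E : ∀ (g : Point → Bool) p t → 𝟙 (g p) * 𝟙 (move p E ≡ᵖ t) ≡ beforeE (paths g p 0) t
last-step-E g p (zero  , y) = *-zeroʳ (𝟙 (g p))
last-step-E g p (suc x , y) = refl

last-step-N : ∀ (g : Point → Bool) p t → 𝟙 (g p) * 𝟙 (move p N ≡ᵖ t) ≡ beforeN (paths g p 0) t
last-step-N g p (x , zero)  =
  trans (cong (λ b → 𝟙 (g p) * 𝟙 b) (∧-zeroʳ (proj₁ p ≡ᵇ x))) (*-zeroʳ (𝟙 (g p)))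
last-step-N g p (x , suc y) = refl

paths-last-step : ∀ (g : Point → Bool) p k t →
  paths g p (suc k) t ≡ 𝟙 (g t) * (beforeE (paths g p k) t + beforeN (paths g p k) t)
paths-last-step g p zero t = begin
    𝟙 (g p) * (𝟙 (g (move p E)) * 𝟙 (move p E ≡ᵖ t) + 𝟙 (g (move p N)) * 𝟙 (move p N ≡ᵖ t))
  ≡⟨ cong (𝟙 (g p) *_) (cong₂ _+_ (𝟙-at-target g (move p E) t) (𝟙-at-target g (move p N) t)) ⟩
    𝟙 (g p) * (𝟙 (g t) * 𝟙 (move p E ≡ᵖ t) + 𝟙 (g t) * 𝟙 (move p N ≡ᵖ t))
  ≡⟨ interchange (𝟙 (g p)) (𝟙 (g t)) _ _ ⟩
    𝟙 (g t) * (𝟙 (g p) * 𝟙 (move p E ≡ᵖ t) + 𝟙 (g p) * 𝟙 (move p N ≡ᵖ t))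
  ≡⟨ cong (𝟙 (g t) *_) (cong₂ _+_ (last-step-E g p t) (last-step-N g p t)) ⟩
    𝟙 (g t) * (beforeE (paths g p 0) t + beforeN (paths g p 0) t)
  ∎
  where
  open ≡-Reasoning
  interchange : ∀ c d x y → c * (d * x + d * y) ≡ d * (c * x + c * y)
  interchange = solve-∀
paths-last-step g p (suc k) t = begin
    𝟙 (g p) * (paths g (move p E) (suc k) t + paths g (move p N) (suc k) t)
  ≡⟨ cong (𝟙 (g p) *_)
          (cong₂ _+_ (paths-last-step g (move p E) k t) (paths-last-step g (move p N) k t)) ⟩
    𝟙 (g p) * (𝟙 (g t) * (wE + sE) + 𝟙 (g t) * (wN + sN))
  ≡⟨ interchange (𝟙 (g p)) (𝟙 (g t)) wE sE wN sN ⟩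
    𝟙 (g t) * (𝟙 (g p) * (wE + wN) + 𝟙 (g p) * (sE + sN))
  ≡⟨ sym (cong (𝟙 (g t) *_)
               (cong₂ _+_ (beforeE-linear (𝟙 (g p)) _ _ t) (beforeN-linear (𝟙 (g p)) _ _ t))) ⟩
    𝟙 (g t) * (beforeE (paths g p (suc k)) t + beforeN (paths g p (suc k)) t)
  ∎
  where
  open ≡-Reasoning
  wE sE wN sN : ℕ
  wE = beforeE (paths g (move p E) k) t
  sE = beforeN (paths g (move p E) k) t
  wN = beforeE (paths g (move p N) k) t
  sN = beforeN (paths g (move p N) k) t
  interchange : ∀ c d a b a′ b′ →
                c * (d * (a + b) + d * (a′ + b′)) ≡ d * (c * (a + a′) + c * (b + b′))
  interchange = solve-∀

atOrigin : ℕ → ℕ → ℕ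
atOrigin zero    zero    = 1
atOrigin zero    (suc y) = 0
atOrigin (suc x) y       = 0

atOrigin-off : ∀ u v {k} → u + v ≡ suc k → atOrigin u v ≡ 0
atOrigin-off zero    zero    ()
atOrigin-off zero    (suc v) _ = refl
atOrigin-off (suc u) v       _ = refl

-- grid g (1 + x) (1 + y) counts the g-paths from (0,0) to (x,y); the shift by one
-- makes row and column 0 the zero boundary of the recursion.
grid : (Point → Bool) → ℕ → ℕ → ℕ
grid g zero    y       = 0
grid g (suc x) zero    = 0
grid g (suc x) (suc y) = 𝟙 (g (x , y)) * (grid g x (suc y) + grid g (suc x) y + atOrigin x y)

grid-step : ∀ (g : Point → Bool) x y → g (suc x , y) ≡ true →
            grid g (suc (suc x)) (suc y) ≡ grid g (suc x) (suc y) + grid g (suc (suc x)) y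
grid-step g x y good =
  trans (cong (λ c → 𝟙 c * (grid g (suc x) (suc y) + grid g (suc (suc x)) y + 0)) good)
        (trans (+-identityʳ _) (+-identityʳ _))

grid-hole : ∀ (g : Point → Bool) x y → g (x , y) ≡ false → grid g (suc x) (suc y) ≡ 0
grid-hole g x y bad = cong (λ c → 𝟙 c * (grid g x (suc y) + grid g (suc x) y + atOrigin x y)) bad

grid-column : ∀ (g g′ : Point → Bool) → (∀ y → g (0 , y) ≡ g′ (0 , y)) →
              ∀ y → grid g 1 y ≡ grid g′ 1 y
grid-column g g′ same zero    = refl
grid-column g g′ same (suc y) =
  cong₂ (λ c s → 𝟙 c * (s + atOrigin 0 y)) (same y) (grid-column g g′ same y)

grid-transpose : ∀ (g : Point → Bool) → (∀ x y → g (x , y) ≡ g (y , x)) →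
                 ∀ a b → grid g a b ≡ grid g b a
grid-transpose g sym-g zero    zero    = refl
grid-transpose g sym-g zero    (suc b) = refl
grid-transpose g sym-g (suc a) zero    = refl
grid-transpose g sym-g (suc a) (suc b) =
  cong₂ (λ c s → 𝟙 c * s) (sym-g a b)
    (cong₂ _+_ (trans (+-comm (grid g a (suc b)) _)
                      (cong₂ _+_ (grid-transpose g sym-g (suc a) b) (grid-transpose g sym-g a (suc b))))
               (atOrigin-comm a b))
  where
  atOrigin-comm : ∀ x y → atOrigin x y ≡ atOrigin y x
  atOrigin-comm zero    zero    = refl
  atOrigin-comm zero    (suc y) = refl
  atOrigin-comm (suc x) zero    = refl
  atOrigin-comm (suc x) (suc y) = refl

paths-from-origin≡grid : ∀ (g : Point → Bool) u v →
                         paths g (0 , 0) (u + v) (u , v) ≡ grid g (suc u) (suc v)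
paths-from-origin≡grid g zero    zero    = refl
paths-from-origin≡grid g zero    (suc v) =
  trans (paths-last-step g (0 , 0) v (0 , suc v))
        (cong (𝟙 (g (0 , suc v)) *_)
              (trans (paths-from-origin≡grid g 0 v) (sym (+-identityʳ _))))
paths-from-origin≡grid g (suc u) v =
  trans (paths-last-step g (0 , 0) (u + v) (suc u , v))
        (cong (𝟙 (g (suc u , v)) *_)
              (trans (cong₂ _+_ (paths-from-origin≡grid g u v) (from-south v)) (sym (+-identityʳ _))))
  where
  from-south : ∀ v → beforeN (paths g (0 , 0) (u + v)) (suc u , v) ≡ grid g (suc (suc u)) v
  from-south zero    = refl
  from-south (suc v) =
    trans (cong (λ k → paths g (0 , 0) k (suc u , v)) (+-suc u v)) (paths-from-origin≡grid g (suc u) v)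

-- Reading paths backwards: g′ is g seen from the target (a,b), so that the paths into (a,b)
-- obey the grid recursion in the distance (u,v) still to go.
module _ (g g′ : Point → Bool) (a b : ℕ)
         (g≡g′ : ∀ {u v x y} → u + x ≡ a → v + y ≡ b → g (x , y) ≡ g′ (u , v)) where

  paths-reversed : ∀ k u v x y → u + v ≡ k → u + x ≡ a → v + y ≡ b →
                   paths g (x , y) k (a , b) ≡ grid g′ (suc u) (suc v)
  paths-reversed zero zero zero x y _ refl refl =
    cong₂ (λ c e → 𝟙 c * 𝟙 e) (g≡g′ refl refl) (cong₂ _∧_ (≡ᵇ-refl x) (≡ᵇ-refl y))
  paths-reversed zero (suc u) v x y () hx hy
  paths-reversed zero zero (suc v) x y () hx hy
  paths-reversed (suc k) u v x y hk hx hy =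
    cong₂ (λ c s → 𝟙 c * s) (g≡g′ hx hy)
      (trans (cong₂ _+_ (east u hk hx) (north v hk hy))
             (trans (sym (+-identityʳ _))
                    (cong (grid g′ u (suc v) + grid g′ (suc u) v +_) (sym (atOrigin-off u v hk)))))
    where
    east : ∀ u → u + v ≡ suc k → u + x ≡ a → paths g (suc x , y) k (a , b) ≡ grid g′ u (suc v)
    east zero     _  refl = paths-unreachable g (suc x , y) k (x , b) (inj₁ (n<1+n x))
    east (suc u′) hk hx   = paths-reversed k u′ v (suc x) y (suc-injective hk) (trans (+-suc u′ x) hx) hy
    north : ∀ v → u + v ≡ suc k → v + y ≡ b → paths g (x , suc y) k (a , b) ≡ grid g′ (suc u) v
    north zero     _  refl = paths-unreachable g (x , suc y) k (a , y) (inj₂ (n<1+n y))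
    north (suc v′) hk hy   =
      paths-reversed k u v′ x (suc y) (suc-injective (trans (sym (+-suc u v′)) hk)) hx
                     (trans (+-suc v′ y) hy)

-- Folding along the line y = x - 1/2

-- The number of paths to (a, b - 1) plus the number of paths to its mirror image
-- ρ (a, b - 1) = (b, a - 1).
folded : (Point → Bool) → ℕ → ℕ → ℕ
folded g a b = grid g (suc a) b + grid g (suc b) a

folded-comm : ∀ (g : Point → Bool) a b → folded g a b ≡ folded g b a
folded-comm g a b = +-comm (grid g (suc a) b) _

-- The mirror image of a step E into p is a step N into the mirror image of p.
folded-step : ∀ (g : Point → Bool) a b → g (suc a , b) ≡ true → g (suc b , a) ≡ true →
  folded g (suc a) (suc b) ≡ folded g a (suc b) + folded g (suc a) b
folded-step g a b good good′ =
  trans (cong₂ _+_ (grid-step g a b good) (grid-step g b a good′))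
        (regroup (grid g (suc a) (suc b)) (grid g (suc (suc a)) b)
                 (grid g (suc b) (suc a)) (grid g (suc (suc b)) a))
  where
  regroup : ∀ w x y z → (w + x) + (y + z) ≡ (w + z) + (x + y)
  regroup = solve-∀

folded-diagonal-hole : ∀ (g : Point → Bool) → (∀ x y → g (x , y) ≡ g (y , x)) → ∀ i →
  g (suc i , suc i) ≡ false → g (suc (suc i) , i) ≡ true →
  folded g (suc i) (suc (suc i)) ≡ folded g i (suc (suc i))
folded-diagonal-hole g sym-g i hole good =
  trans (cong₂ _+_ (grid-hole g (suc i) (suc i) hole) (grid-step g (suc i) i good))
        (cong (_+ grid g (suc (suc (suc i))) i) (grid-transpose g sym-g (suc (suc i)) (suc i)))

folded-fixed-hole : ∀ (g : Point → Bool) i → g (suc i , i) ≡ false → folded g (suc i) (suc i) ≡ 0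
folded-fixed-hole g i hole = cong (λ z → z + z) (grid-hole g (suc i) i hole)

badSubdiagonal : ℕ → Point → Bool
badSubdiagonal n (x , y) = (x ≡ᵇ suc y) ∧ (x ≤ᵇ n)

badP-rotated : ∀ n r {u v x y} → u + x ≡ n + r → suc (v + y) ≡ n + r →
               badP r (x , y) ≡ badSubdiagonal n (u , v)
badP-rotated n r {u} {v} {x} {y} hx hy =
  cong₂ _∧_ (≡ᵇ-shift {u} {suc v} {x} {y} (trans hx (sym hy))) (≤ᵇ-shift {u} {n} {x} {r} hx)

module Reflection (n : ℕ) where

  goodQ goodSub : Point → Bool
  goodQ   = avoid (badQ n)
  goodSub = avoid (badSubdiagonal n)

  goodQ-diagonal : ∀ i → suc i ≤ n → goodQ (suc i , suc i) ≡ false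
  goodQ-diagonal i i<n = cong not (cong₂ _∧_ (≡ᵇ-refl i) (T⇒≡true (≤⇒≤ᵇ i<n)))

  goodQ-off-diagonal : ∀ {x y} → x ≢ y → goodQ (x , y) ≡ true
  goodQ-off-diagonal {x} x≢y = cong (λ b → not (b ∧ ((1 ≤ᵇ x) ∧ (x ≤ᵇ n)))) (≢⇒≡ᵇ-false x≢y)

  goodQ≡goodSub-column : ∀ y → goodQ (0 , y) ≡ goodSub (0 , y)
  goodQ≡goodSub-column y = cong not (∧-zeroʳ (0 ≡ᵇ y))

  goodQ-false : ∀ x y → goodQ (x , y) ≡ false → x ≡ y × x ≤ n
  goodQ-false x y e with Equivalence.to T-∧ (not≡false⇒T e)
  ... | t , t′ = ≡ᵇ⇒≡ x y t , ≤ᵇ⇒≤ x n (proj₂ (Equivalence.to T-∧ t′))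

  goodQ-sym : ∀ x y → goodQ (x , y) ≡ goodQ (y , x)
  goodQ-sym x y with x ≟ y
  ... | yes refl = refl
  ... | no  x≢y  = trans (goodQ-off-diagonal x≢y) (sym (goodQ-off-diagonal (x≢y ∘ sym)))

  goodSub-barrier : ∀ i → suc i ≤ n → goodSub (suc i , i) ≡ false
  goodSub-barrier i i<n = cong not (cong₂ _∧_ (≡ᵇ-refl i) (T⇒≡true (≤⇒≤ᵇ i<n)))

  goodSub-off : ∀ {x y} → x ≢ suc y → goodSub (x , y) ≡ true
  goodSub-off {x} x≢y = cong (λ b → not (b ∧ (x ≤ᵇ n))) (≢⇒≡ᵇ-false x≢y)

  goodSub-beyond : ∀ {x y} → n < x → goodSub (x , y) ≡ true
  goodSub-beyond {x} {y} n<x =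
    cong not (trans (cong ((x ≡ᵇ suc y) ∧_) (¬T⇒≡false (<⇒≱ n<x ∘ ≤ᵇ⇒≤ x n)))
                    (∧-zeroʳ (x ≡ᵇ suc y)))

  goodSub-false : ∀ x y → goodSub (x , y) ≡ false → x ≡ suc y × x ≤ n
  goodSub-false x y e with Equivalence.to T-∧ (not≡false⇒T e)
  ... | t , t′ = ≡ᵇ⇒≡ x (suc y) t , ≤ᵇ⇒≤ x n t′

  FoldsAgree : ℕ → ℕ → Set
  FoldsAgree a b = folded goodQ a b ≡ folded goodSub a b

  -- At a forbidden point of Q both folded counts reduce to the one west of it: for Q
  -- because the point contributes nothing, for the other family because the fixed
  -- point of ρ south of it contributes nothing.
  on-diagonal : ∀ i j → suc i ≡ j × suc i ≤ n →
                FoldsAgree i (suc (suc i)) → FoldsAgree (suc i) (suc j)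
  on-diagonal i .(suc i) (refl , i<n) west = begin
      folded goodQ (suc i) (suc (suc i))
    ≡⟨ folded-diagonal-hole goodQ goodQ-sym i (goodQ-diagonal i i<n)
                            (goodQ-off-diagonal (n≢2+n i ∘ sym)) ⟩
      folded goodQ i (suc (suc i))
    ≡⟨ west ⟩
      folded goodSub i (suc (suc i))
    ≡⟨ sym (+-identityʳ _) ⟩
      folded goodSub i (suc (suc i)) + 0
    ≡⟨ cong (folded goodSub i (suc (suc i)) +_)
            (sym (folded-fixed-hole goodSub i (goodSub-barrier i i<n))) ⟩
      folded goodSub i (suc (suc i)) + folded goodSub (suc i) (suc i)
    ≡⟨ sym (folded-step goodSub i (suc i) (goodSub-off {suc i} {suc i} (1+n≢n ∘ sym))
                                          (goodSub-off {suc (suc i)} {i} 1+n≢n)) ⟩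
      folded goodSub (suc i) (suc (suc i))
    ∎
    where
    open ≡-Reasoning

  off-diagonal : ∀ a b → a ≤ b → ¬ (suc a ≡ suc b × suc a ≤ n) → goodQ (suc a , b) ≡ true →
                 FoldsAgree a (suc b) → FoldsAgree (suc a) b → FoldsAgree (suc a) (suc b)
  off-diagonal a b a≤b off good west south = begin
      folded goodQ (suc a) (suc b)
    ≡⟨ folded-step goodQ a b good (goodQ-off-diagonal 1+b≢a) ⟩
      folded goodQ a (suc b) + folded goodQ (suc a) b
    ≡⟨ cong₂ _+_ west south ⟩
      folded goodSub a (suc b) + folded goodSub (suc a) b
    ≡⟨ sym (folded-step goodSub a b
              (goodSub-good λ (e , a<n) → off (cong suc e , a<n))
              (goodSub-good λ (e , b<n) → off (cong suc (sym e) , subst (λ z → suc z ≤ n) e b<n))) ⟩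
      folded goodSub (suc a) (suc b)
    ∎
    where
    open ≡-Reasoning
    1+b≢a : suc b ≢ a
    1+b≢a e = 1+n≰n (subst (_≤ b) (sym e) a≤b)
    goodSub-good : ∀ {x y} → ¬ (x ≡ y × suc x ≤ n) → goodSub (suc x , y) ≡ true
    goodSub-good {x} {y} off′ with goodSub (suc x , y) in e
    ... | true  = refl
    ... | false = ⊥-elim (off′ (Product.map suc-injective id (goodSub-false (suc x) y e)))

  inductive-step : ∀ a b → a ≤ b → ¬ (suc a ≡ suc b × suc a ≤ n) →
    FoldsAgree a (suc (suc a)) → FoldsAgree a (suc b) →
    (suc a ≤ b → ¬ (suc a ≡ b × suc a ≤ n) → FoldsAgree (suc a) b) → FoldsAgree a (suc a) →
    FoldsAgree (suc a) (suc b)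
  inductive-step a b a≤b off diagonal west south mirror
    with true-or-false (goodQ (suc a , b)) | m≤n⇒m<n∨m≡n a≤b
  ... | inj₂ hole | _        = on-diagonal a b (goodQ-false (suc a) b hole) diagonal
  ... | inj₁ good | inj₁ a<b =
    off-diagonal a b a≤b off good west
      (south a<b λ { (refl , a<n) → case trans (sym good) (goodQ-diagonal a a<n) of λ () })
  ... | inj₁ good | inj₂ refl =
    off-diagonal a a a≤b off good west
      (trans (folded-comm goodQ (suc a) a) (trans mirror (folded-comm goodSub a (suc a))))

  -- By folded-comm it suffices to take a ≤ b, which leaves out the mirror images of
  -- the forbidden points of Q.
  folds-agree : ∀ a b → a ≤ b → ¬ (a ≡ b × a ≤ n) → FoldsAgree a b
  folds-agree zero    b       _         _   = cong (_+ 0) (grid-column goodQ goodSub goodQ≡goodSub-column b)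
  folds-agree (suc a) (suc b) (s≤s a≤b) off =
    inductive-step a b a≤b off
      (folds-agree a (suc (suc a)) (m≤n⇒m≤1+n (n≤1+n a)) (n≢2+n a ∘ proj₁))
      (folds-agree a (suc b) (m≤n⇒m≤1+n a≤b) (λ (e , _) → 1+n≰n (subst (_≤ b) e a≤b)))
      (folds-agree (suc a) b)
      (folds-agree a (suc a) (n≤1+n a) (1+n≢n ∘ sym ∘ proj₁))

theorem6 : (n r : ℕ) → n ≥ 1 → r ≥ 1 → P n r ≡ Q r n
theorem6 n@(suc n′) r _ r≥1 = begin
    P n r
  ≡⟨ countAvoiding≡paths (badP r) (suc m) m ⟩
    paths (avoid (badP r)) (0 , 0) (suc m + m) (suc m , m)
  ≡⟨ paths-reversed (avoid (badP r)) goodSub (suc m) m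
                    (λ hx hy → cong not (badP-rotated n r hx (cong suc hy)))
                    (suc m + m) (suc m) m 0 0 refl (+-identityʳ _) (+-identityʳ _) ⟩
    grid goodSub (suc (suc m)) (suc m)
  ≡⟨ grid-step goodSub m m (goodSub-beyond n<1+m) ⟩
    folded goodSub m (suc m)
  ≡⟨ sym (folds-agree m (suc m) (n≤1+n m) (<⇒≢ (n<1+n m) ∘ proj₁)) ⟩
    folded goodQ m (suc m)
  ≡⟨ sym (grid-step goodQ m m (goodQ-off-diagonal {suc m} {m} 1+n≢n)) ⟩
    grid goodQ (suc (suc m)) (suc m)
  ≡⟨ sym (paths-from-origin≡grid goodQ (suc m) m) ⟩
    paths goodQ (0 , 0) (suc m + m) (suc m , m)
  ≡⟨ sym (countAvoiding≡paths (badQ n) (suc m) m) ⟩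
    countAvoiding (badQ n) (n + r) (n + r ∸ 1)
  ≡⟨ cong (λ k → countAvoiding (badQ n) k (k ∸ 1)) (+-comm n r) ⟩
    Q r n
  ∎
  where
  open ≡-Reasoning
  open Reflection n
  m = n′ + r
  n<1+m : n < suc m
  n<1+m = s≤s (subst (n′ <_) (+-comm r n′) (m<n+m n′ r≥1))
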